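{- Let $G_1$ and $G_2$ be connected graphs on disjoint vertex sets, let $v_1\in V(G_1)$ and $v_2\in V(G_2)$, and let $G$ be the graph with $V(G)=V(G_1)\cup V(G_2)$ and $E(G)=E(G_1)\cup E(G_2)\cup\{v_1v_2\}$. Then $$\operatorname{cdim}(G)=\begin{cases}\operatorname{cdim}(G_1)+\operatorname{cdim}(G_2)+1 & \text{if both } G_1 \text{ and } G_2 \text{ force a } \mathbb{1} \text{ representation},\\ \operatorname{cdim}(G_1)+\operatorname{cdim}(G_2) & \text{otherwise.}\end{cases}$$
   Context: All graphs are nonempty, finite, simple and undirected. For distinct vertices $v,w$ of a graph $G$, $\kappa_G(v,w)$ denotes the maximum number of internally vertex-disjoint $v$–$w$ paths in $G$; by convention $\kappa_G(v,v)=\infty$. For an ordered vertex set $W=\{w_1,\ldots,w_k\}\subseteq V(G)$, the connectivity representation of $v$ is $r_G(v,W)=[\kappa_G(v,w_1),\ldots,\kappa_G(v,w_k)]$. $W$ is resolving for $G$ if $r_G(v_1,W)=r_G(v_2,W)$ implies $v_1=v_2$ for all $v_1,v_2\in V(G)$. A (connectivity) basis is a resolving set of minimum cardinality, and $\operatorname{cdim}(G)$ is its cardinality. A graph $G$ forces a $\mathbb{1}$ representation if for every basis $B$ of $G$ there is a vertex $v\in V(G)$ with $r_G(v,B)=\mathbb{1}=[1,\ldots,1]$, the all-ones vector of length $|B|$ (for $B=\emptyset$ this is the empty vector, so a single-vertex graph forces a $\mathbb{1}$ representation). -}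

module Defs where

open import Data.Nat using (ℕ; zero; suc; _+_; _≤_)
open import Data.Fin using (Fin; _↑ˡ_; _↑ʳ_; splitAt; _≟_)
open import Data.Bool using (Bool; true; false; T)
open import Data.Sum using (_⊎_; inj₁; inj₂)
open import Data.Product using (Σ; ∃; _×_; _,_)
open import Data.List using (List; []; _∷_; _∷ʳ_; length)
open import Data.List.Relation.Unary.Linked using (Linked)
open import Data.List.Relation.Unary.Unique.Propositional using (Unique)
open import Data.List.Relation.Unary.AllPairs using (AllPairs)
open import Data.List.Relation.Unary.All using (All)
open import Data.List.Relation.Binary.Disjoint.Propositional using (Disjoint)
open import Relation.Binary.PropositionalEquality using (_≡_; _≢_)
open import Relation.Nullary using (¬_)
open import Relation.Nullary.Decidable using (⌊_⌋)
open import Function.Definitions using (Injective)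

record Graph (n : ℕ) : Set where
  field
    adj     : Fin n → Fin n → Bool
    adj-sym : ∀ u v → adj u v ≡ adj v u
    adj-irr : ∀ v → adj v v ≡ false
open Graph public

Adj : ∀ {n} → Graph n → Fin n → Fin n → Set
Adj G u v = T (adj G u v)

-- A v–w path, given by its list of interior vertices: the vertex sequence
-- v ∷ interior ++ [w] consists of distinct vertices, consecutive ones adjacent.
IsPath : ∀ {n} → Graph n → Fin n → Fin n → List (Fin n) → Set
IsPath G v w is = Unique ((v ∷ is) ∷ʳ w) × Linked (Adj G) ((v ∷ is) ∷ʳ w)

-- A family of pairwise distinct, internally vertex-disjoint v–w paths
-- (each path represented by its interior).
IsDisjointPathFamily : ∀ {n} → Graph n → Fin n → Fin n → List (List (Fin n)) → Set
IsDisjointPathFamily G v w ps =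
  All (IsPath G v w) ps × AllPairs (λ p q → p ≢ q × Disjoint p q) ps

Connected : ∀ {n} → Graph n → Set
Connected G = ∀ u v → u ≢ v → ∃ λ is → IsPath G u v is

data ℕ∞ : Set where
  fin : ℕ → ℕ∞
  ∞   : ℕ∞

HasConn : ∀ {n} → Graph n → Fin n → Fin n → ℕ∞ → Set
HasConn G v w ∞       = v ≡ w
HasConn G v w (fin k) =
  v ≢ w ×
  (∃ λ ps → IsDisjointPathFamily G v w ps × length ps ≡ k) ×
  (∀ ps → IsDisjointPathFamily G v w ps → length ps ≤ k)

SameRep : ∀ {n k} → Graph n → (Fin k → Fin n) → Fin n → Fin n → Set
SameRep G W v₁ v₂ = ∀ i → ∃ λ x → HasConn G v₁ (W i) x × HasConn G v₂ (W i) x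

-- W (with distinct entries, i.e. a vertex set) is resolving.
Resolving : ∀ {n k} → Graph n → (Fin k → Fin n) → Set
Resolving G W = Injective _≡_ _≡_ W × (∀ v₁ v₂ → SameRep G W v₁ v₂ → v₁ ≡ v₂)

IsBasis : ∀ {n k} → Graph n → (Fin k → Fin n) → Set
IsBasis {n} {k} G W = Resolving G W × (∀ m (U : Fin m → Fin n) → Resolving G U → k ≤ m)

IsCdim : ∀ {n} → Graph n → ℕ → Set
IsCdim {n} G k = Σ (Fin k → Fin n) (IsBasis G)

ForcesOne : ∀ {n} → Graph n → Set
ForcesOne {n} G = ∀ k (B : Fin k → Fin n) → IsBasis G B →
  ∃ λ v → ∀ i → HasConn G v (B i) (fin 1)

-- The graph G₁ ∪ G₂ + v₁v₂ on Fin (n₁ + n₂): G₁ on the left copy, G₂ on the right.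
bridgeAdj : ∀ {n₁ n₂} → Graph n₁ → Graph n₂ → Fin n₁ → Fin n₂ →
  Fin (n₁ + n₂) → Fin (n₁ + n₂) → Bool
bridgeAdj {n₁} G₁ G₂ v₁ v₂ x y with splitAt n₁ x | splitAt n₁ y
... | inj₁ a | inj₁ b = adj G₁ a b
... | inj₂ a | inj₂ b = adj G₂ a b
... | inj₁ a | inj₂ b = ⌊ a ≟ v₁ ⌋ Data.Bool.∧ ⌊ b ≟ v₂ ⌋
... | inj₂ a | inj₁ b = ⌊ b ≟ v₁ ⌋ Data.Bool.∧ ⌊ a ≟ v₂ ⌋

private
  open import Relation.Binary.PropositionalEquality using (refl)
  open import Data.Bool.Properties using (∧-comm)

  bridge-sym : ∀ {n₁ n₂} (G₁ : Graph n₁) (G₂ : Graph n₂) v₁ v₂ x y →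
    bridgeAdj G₁ G₂ v₁ v₂ x y ≡ bridgeAdj G₁ G₂ v₁ v₂ y x
  bridge-sym {n₁} G₁ G₂ v₁ v₂ x y with splitAt n₁ x | splitAt n₁ y
  ... | inj₁ a | inj₁ b = adj-sym G₁ a b
  ... | inj₂ a | inj₂ b = adj-sym G₂ a b
  ... | inj₁ a | inj₂ b = refl
  ... | inj₂ a | inj₁ b = refl

  bridge-irr : ∀ {n₁ n₂} (G₁ : Graph n₁) (G₂ : Graph n₂) v₁ v₂ x →
    bridgeAdj G₁ G₂ v₁ v₂ x x ≡ false
  bridge-irr {n₁} G₁ G₂ v₁ v₂ x with splitAt n₁ x
  ... | inj₁ a = adj-irr G₁ a
  ... | inj₂ a = adj-irr G₂ a

bridge : ∀ {n₁ n₂} → Graph n₁ → Graph n₂ → Fin n₁ → Fin n₂ → Graph (n₁ + n₂)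
bridge G₁ G₂ v₁ v₂ = record
  { adj = bridgeAdj G₁ G₂ v₁ v₂
  ; adj-sym = bridge-sym G₁ G₂ v₁ v₂
  ; adj-irr = bridge-irr G₁ G₂ v₁ v₂ }

{-# OPTIONS --safe #-}
-- Let H join G₁ and G₂ by the bridge v₁v₂. Since G₁ and G₂ are connected and every
-- path between the two sides uses the bridge, κ_H(x, y) = 1 for x, y on different
-- sides, while on one side κ_H is computed inside that side (a path leaving G₁ must
-- come back through v₁). Hence the two parts of a resolving set W of H resolve G₁
-- and G₂, so cdim H ≥ cdim G₁ + cdim G₂; and if both parts are bases of graphs
-- forcing 𝟙, the two 𝟙 vertices get the same representation in H, so then
-- cdim H ≥ cdim G₁ + cdim G₂ + 1. Conversely B₁ ∪ B₂ resolves H as soon as one Bᵢ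
-- leaves no vertex with representation 𝟙. If Gᵢ does not force 𝟙 such a basis
-- exists (found by exhaustive search, κ being computable); otherwise adding the
-- 𝟙 vertex x to B₁ gives one, since a vertex with 𝟙 on x ∷ B₁ would share x's
-- representation on B₁ although κ(x, x) = ∞.
module Submission where

open import Defs
open import Data.Nat as ℕ using (ℕ; zero; suc; _+_; _≤_; _<_; z≤n; s≤s)
open import Data.Nat.Properties
  using (≤-antisym; ≤-trans; ≤-pred; n≤1+n; m≤n⇒m<n∨m≡n; +-suc; +-comm; +-mono-≤; +-mono-<-≤; +-mono-≤-<)
open import Data.Fin using (Fin; zero; suc; _≟_; join; splitAt; _↑ˡ_; _↑ʳ_)
open import Data.Fin.Properties
  using ( any?; all?; injective⇒≤; suc-injective; join-splitAt; ↑ˡ-injective; ↑ʳ-injective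
        ; splitAt-↑ˡ; splitAt-↑ʳ; splitAt⁻¹-↑ˡ; splitAt⁻¹-↑ʳ)
open import Data.Bool using (T; _∧_)
open import Data.Bool.Properties using (T-∧)
open import Data.Maybe using (just)
import Data.Maybe.Relation.Binary.Connected as Maybe
open import Data.Unit using (⊤; tt)
open import Data.Empty using (⊥; ⊥-elim)
open import Data.Sum as Sum using (_⊎_; inj₁; inj₂)
open import Data.Product as Product using (∃; _×_; _,_; proj₁; proj₂)
open import Data.Vec.Functional as Vec using (Vector; head; tail)
open import Data.Vec.Functional.Properties using (∷-cong; lookup-++ˡ; lookup-++ʳ)
open import Data.List using (List; []; _∷_; _∷ʳ_; _++_; length; map; lookup; last; tabulate)
open import Data.List.Properties
  using ( length-++-≤ˡ; length-map; length-tabulate; ≡-dec; ++-assoc; ∷-injective; ∷-injectiveˡ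
        ; map-++; map-injective)
open import Data.List.Relation.Unary.All as All using (All; []; _∷_)
import Data.List.Relation.Unary.All.Properties as All
open import Data.List.Relation.Unary.AllPairs as AllPairs using ([]; _∷_)
import Data.List.Relation.Unary.AllPairs.Properties as AllPairs
open import Data.List.Relation.Unary.Any as Any using (here; there)
open import Data.List.Relation.Unary.Any.Properties using (lookup-index)
open import Data.List.Relation.Unary.Linked as Linked using (Linked; []; [-]; _∷_; linked?)
import Data.List.Relation.Unary.Linked.Properties as Linked
open import Data.List.Relation.Unary.Unique.Propositional using (Unique)
import Data.List.Relation.Unary.Unique.Propositional.Properties as Unique
open import Data.List.Relation.Unary.Unique.Propositional.Properties using (Unique[x∷xs]⇒x∉xs)
open import Data.List.Relation.Binary.Disjoint.Propositional using (Disjoint)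
open import Data.List.Membership.Propositional using (_∈_)
open import Data.List.Membership.Propositional.Properties
  using (∈-lookup; ∈-tabulate⁺; ∈-map⁺; ∈-map⁻; ∈-++⁺ˡ; ∈-++⁺ʳ; ∈-++⁻)
open import Relation.Binary.PropositionalEquality using (_≡_; _≢_; _≗_; refl; sym; trans; cong; subst)
open Relation.Binary.PropositionalEquality.≡-Reasoning
open import Relation.Binary.Definitions using (DecidableEquality)
open import Relation.Nullary using (¬_; Dec; yes; no; _×-dec_; _→-dec_; ¬?)
open import Relation.Nullary.Decidable using (map′; T?; decidable-stable; ⌊_⌋; fromWitness)
open import Relation.Unary using (Decidable)
open import Function.Definitions using (Injective)
open import Function.Bundles using (Equivalence)

Unique⇒lookup-injective : ∀ {A : Set} {xs : List A} → Unique xs → Injective _≡_ _≡_ (lookup xs)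
Unique⇒lookup-injective {xs = _ ∷ _} (_ ∷ _) {zero} {zero} _ = refl
Unique⇒lookup-injective {xs = _ ∷ _} (x∉xs ∷ _) {zero} {suc j} e =
  ⊥-elim (All.lookup x∉xs (∈-lookup j) e)
Unique⇒lookup-injective {xs = _ ∷ _} (x∉xs ∷ _) {suc i} {zero} e =
  ⊥-elim (All.lookup x∉xs (∈-lookup i) (sym e))
Unique⇒lookup-injective {xs = _ ∷ _} (_ ∷ u) {suc i} {suc j} e = cong suc (Unique⇒lookup-injective u e)

Unique⇒length≤ : ∀ {n} {xs : List (Fin n)} → Unique xs → length xs ≤ n
Unique⇒length≤ u = injective⇒≤ (Unique⇒lookup-injective u)

last-∷ʳ : ∀ {A : Set} (xs : List A) {x} → last (xs ∷ʳ x) ≡ just x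
last-∷ʳ [] = refl
last-∷ʳ (_ ∷ []) = refl
last-∷ʳ (_ ∷ y ∷ xs) = last-∷ʳ (y ∷ xs)

map-∷ʳ : ∀ {A B : Set} (f : A → B) xs x → map f (xs ∷ʳ x) ≡ map f xs ∷ʳ f x
map-∷ʳ f xs x = map-++ f xs (x ∷ [])

Searchable : {A : Set} → (A → Set) → Set₁
Searchable {A} Q = ∀ {P : A → Set} → Decidable P → Dec (∃ λ x → Q x × P x)

searchable-Fin : ∀ {n} → Searchable {Fin n} (λ _ → ⊤)
searchable-Fin P? = map′ (λ (x , p) → x , tt , p) (λ (x , _ , p) → x , p) (any? P?)

BoundedList : {A : Set} → ℕ → (A → Set) → List A → Set
BoundedList L Q xs = length xs ≤ L × All Q xs

searchable-BoundedList : ∀ {A : Set} {Q : A → Set} → Searchable Q → ∀ L → Searchable (BoundedList L Q)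
searchable-BoundedList s zero P? =
  map′ (λ p → [] , (z≤n , []) , p) (λ { ([] , _ , p) → p }) (P? [])
searchable-BoundedList s (suc L) P? with P? [] | s (λ x → searchable-BoundedList s L (λ xs → P? (x ∷ xs)))
... | yes p | _ = yes ([] , (z≤n , []) , p)
... | no _ | yes (x , qx , xs , (len , qxs) , p) = yes (x ∷ xs , (s≤s len , qx ∷ qxs) , p)
... | no ¬p | no ¬q = no λ
  { ([] , _ , p) → ¬p p
  ; (x ∷ xs , (s≤s len , qx ∷ qxs) , p) → ¬q (x , qx , xs , (len , qxs) , p) }

greatest : ∀ {P : ℕ → Set} → Decidable P → P 0 → ∀ N →
  ∃ λ k → P k × (∀ {j} → j ≤ N → P j → j ≤ k)
greatest P? p₀ zero = 0 , p₀ , λ j≤0 _ → j≤0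
greatest {P} P? p₀ (suc N) with P? (suc N) | greatest P? p₀ N
... | yes p | _ = suc N , p , λ j≤1+N _ → j≤1+N
... | no ¬p | k , pk , max = k , pk , below
  where
  below : ∀ {j} → j ≤ suc N → P j → j ≤ k
  below j≤1+N pj with m≤n⇒m<n∨m≡n j≤1+N
  ... | inj₁ j<1+N = max (≤-pred j<1+N) pj
  ... | inj₂ refl = ⊥-elim (¬p pj)

any-Vector? : ∀ {n} k {P : Vector (Fin n) k → Set} → (∀ {f g} → f ≗ g → P f → P g) →
  Decidable P → Dec (∃ P)
any-Vector? zero resp P? = map′ (λ p → Vec.[] , p) (λ (f , p) → resp (λ ()) p) (P? Vec.[])
any-Vector? (suc k) resp P? =
  map′ (λ (x , f , p) → x Vec.∷ f , p)
       (λ (f , p) → head f , tail f , resp (∷-cong refl (λ _ → refl)) p)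
    (any? λ x → any-Vector? k (λ f≗g → resp (∷-cong refl f≗g)) (λ f → P? (x Vec.∷ f)))

++-injective : ∀ {A : Set} {m n} {f : Vector A m} {g : Vector A n} →
  Injective _≡_ _≡_ f → Injective _≡_ _≡_ g → (∀ i j → f i ≢ g j) →
  Injective _≡_ _≡_ (f Vec.++ g)
++-injective {m = m} {n} {f} {g} f-injective g-injective f≢g {i} {j} e = begin
  i                         ≡⟨ join-splitAt m n i ⟨
  join m n (splitAt m i)    ≡⟨ cong (join m n) ([f,g]-injective (splitAt m i) (splitAt m j) e) ⟩
  join m n (splitAt m j)    ≡⟨ join-splitAt m n j ⟩
  j                         ∎
  where
  [f,g]-injective : ∀ s t → Sum.[ f , g ] s ≡ Sum.[ f , g ] t → s ≡ t
  [f,g]-injective (inj₁ x) (inj₁ y) e = cong inj₁ (f-injective e)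
  [f,g]-injective (inj₁ x) (inj₂ y) e = ⊥-elim (f≢g x y e)
  [f,g]-injective (inj₂ x) (inj₁ y) e = ⊥-elim (f≢g y x (sym e))
  [f,g]-injective (inj₂ x) (inj₂ y) e = cong inj₂ (g-injective e)

module Connectivity {n} (G : Graph n) where
  open import Data.List.Relation.Unary.Unique.DecPropositional (_≟_ {n}) using (unique?)
  open import Data.List.Relation.Binary.Disjoint.DecPropositional (_≟_ {n}) using (disjoint?)

  isPath? : ∀ v w → Decidable (IsPath G v w)
  isPath? v w is = unique? _ ×-dec linked? (λ x y → T? (adj G x y)) _

  isDisjointPathFamily? : ∀ v w → Decidable (IsDisjointPathFamily G v w)
  isDisjointPathFamily? v w ps = All.all? (isPath? v w) ps
    ×-dec AllPairs.allPairs? (λ p q → ¬? (≡-dec _≟_ p q) ×-dec disjoint? p q) ps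

  path-length≤ : ∀ {v w is} → IsPath G v w is → length is ≤ n
  path-length≤ {is = is} (u , _) = ≤-trans (≤-trans (length-++-≤ˡ is) (n≤1+n _)) (Unique⇒length≤ u)

  -- Distinct internally disjoint paths have distinct first interior vertices,
  -- and at most one of them has empty interior.
  family-length≤ : ∀ {v w ps} → IsDisjointPathFamily G v w ps → length ps ≤ suc n
  family-length≤ {ps = ps} (_ , distinct) =
    subst (_≤ suc n) (length-map first ps) (Unique⇒length≤ (AllPairs.map⁺ (AllPairs.map first-≢ distinct)))
    where
    first : List (Fin n) → Fin (suc n)
    first [] = zero
    first (x ∷ _) = suc x
    first-≢ : ∀ {p q} → p ≢ q × Disjoint p q → first p ≢ first q
    first-≢ {[]} {[]} (p≢q , _) _ = p≢q refl
    first-≢ {x ∷ _} {y ∷ _} (_ , p#q) e = p#q (here refl , here (suc-injective e))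

  HasFamilyOfSize : Fin n → Fin n → ℕ → Set
  HasFamilyOfSize v w k = ∃ λ ps → IsDisjointPathFamily G v w ps × length ps ≡ k

  hasFamilyOfSize? : ∀ v w → Decidable (HasFamilyOfSize v w)
  hasFamilyOfSize? v w k = map′ (λ (ps , _ , p) → ps , p) (λ (ps , p) → ps , bounded (proj₁ p) , p)
    (searchable-BoundedList (searchable-BoundedList searchable-Fin n) (suc n)
      (λ ps → isDisjointPathFamily? v w ps ×-dec (length ps ℕ.≟ k)))
    where
    bounded : ∀ {ps} → IsDisjointPathFamily G v w ps → BoundedList (suc n) (BoundedList n (λ _ → ⊤)) ps
    bounded fam =
      family-length≤ fam , All.map (λ p → path-length≤ p , All.universal (λ _ → tt) _) (proj₁ fam)

  hasConn : ∀ v w → ∃ (HasConn G v w)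
  hasConn v w with v ≟ w
  ... | yes v≡w = ∞ , v≡w
  ... | no v≢w with greatest (hasFamilyOfSize? v w) ([] , ([] , []) , refl) (suc n)
  ...   | k , has-k , max = fin k , v≢w , has-k , λ ps fam → max (family-length≤ fam) (ps , fam , refl)

  HasConn-functional : ∀ {v w x y} → HasConn G v w x → HasConn G v w y → x ≡ y
  HasConn-functional {x = ∞} {∞} _ _ = refl
  HasConn-functional {x = ∞} {fin _} v≡w (v≢w , _) = ⊥-elim (v≢w v≡w)
  HasConn-functional {x = fin _} {∞} (v≢w , _) v≡w = ⊥-elim (v≢w v≡w)
  HasConn-functional {x = fin k} {fin l} (_ , (ps , fam , refl) , max) (_ , (qs , fam′ , refl) , max′) =
    cong fin (≤-antisym (max′ ps fam) (max qs fam′))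

-- Opaque: κ is only used through κ-spec, and unfolding the search would block unification.
opaque
  κ : ∀ {n} → Graph n → Fin n → Fin n → ℕ∞
  κ G v w = proj₁ (Connectivity.hasConn G v w)

  κ-spec : ∀ {n} (G : Graph n) v w → HasConn G v w (κ G v w)
  κ-spec G v w = proj₂ (Connectivity.hasConn G v w)

HasConn⇒≡κ : ∀ {n} {G : Graph n} {v w x} → HasConn G v w x → x ≡ κ G v w
HasConn⇒≡κ {G = G} {v} {w} h = Connectivity.HasConn-functional G h (κ-spec G v w)

κ-refl : ∀ {n} (G : Graph n) v → κ G v v ≡ ∞
κ-refl G v = sym (HasConn⇒≡κ {G = G} refl)

rep : ∀ {n k} → Graph n → (Fin k → Fin n) → Fin n → Fin k → ℕ∞
rep G W v i = κ G v (W i)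

module _ {n k} {G : Graph n} {W : Fin k → Fin n} {v₁ v₂ : Fin n} where

  SameRep⇒rep≗ : SameRep G W v₁ v₂ → rep G W v₁ ≗ rep G W v₂
  SameRep⇒rep≗ same i = let (_ , h₁ , h₂) = same i in
    trans (sym (HasConn⇒≡κ h₁)) (HasConn⇒≡κ h₂)

  rep≗⇒SameRep : rep G W v₁ ≗ rep G W v₂ → SameRep G W v₁ v₂
  rep≗⇒SameRep e i =
    rep G W v₁ i , κ-spec G v₁ (W i) , subst (HasConn G v₂ (W i)) (sym (e i)) (κ-spec G v₂ (W i))

  Resolving⇒rep-injective : Resolving G W → rep G W v₁ ≗ rep G W v₂ → v₁ ≡ v₂
  Resolving⇒rep-injective (_ , resolves) e = resolves v₁ v₂ (rep≗⇒SameRep e)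

rep-injective⇒Resolving : ∀ {n k} {G : Graph n} {W : Fin k → Fin n} → Injective _≡_ _≡_ W →
  (∀ {v₁ v₂} → rep G W v₁ ≗ rep G W v₂ → v₁ ≡ v₂) → Resolving G W
rep-injective⇒Resolving W-injective rep-injective =
  W-injective , λ _ _ same → rep-injective (SameRep⇒rep≗ same)

HasOneRep : ∀ {n k} → Graph n → (Fin k → Fin n) → Fin n → Set
HasOneRep G B v = ∀ i → rep G B v i ≡ fin 1

OneRepFree : ∀ {n k} → Graph n → (Fin k → Fin n) → Set
OneRepFree G B = ¬ ∃ (HasOneRep G B)

ForcesOne⇒HasOneRep : ∀ {n k} {G : Graph n} {B : Fin k → Fin n} →
  ForcesOne G → IsBasis G B → ∃ (HasOneRep G B)
ForcesOne⇒HasOneRep forces basis = let (v , ones) = forces _ _ basis in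
  v , λ i → sym (HasConn⇒≡κ (ones i))

LowerBound : ∀ {n} → Graph n → ℕ → Set
LowerBound {n} G k = ∀ m (U : Fin m → Fin n) → Resolving G U → k ≤ m

_≟∞_ : DecidableEquality ℕ∞
fin k ≟∞ fin l = map′ (cong fin) (λ { refl → refl }) (k ℕ.≟ l)
fin _ ≟∞ ∞ = no λ ()
∞ ≟∞ fin _ = no λ ()
∞ ≟∞ ∞ = yes refl

module _ {n} (G : Graph n) where

  resolving? : ∀ {k} (W : Fin k → Fin n) → Dec (Resolving G W)
  resolving? W =
    map′ (λ (inj , res) → rep-injective⇒Resolving (inj _ _) (res _ _))
         (λ R → (λ _ _ → proj₁ R) , (λ _ _ → Resolving⇒rep-injective R))
      ((all? λ i → all? λ j → (W i ≟ W j) →-dec (i ≟ j)) ×-dec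
       (all? λ v₁ → all? λ v₂ →
         (all? λ i → rep G W v₁ i ≟∞ rep G W v₂ i) →-dec (v₁ ≟ v₂)))

  hasOneRep? : ∀ {k} (B : Fin k → Fin n) → Decidable (HasOneRep G B)
  hasOneRep? B v = all? λ i → rep G B v i ≟∞ fin 1

κ≡fin⇒≢ : ∀ {n} {G : Graph n} {v w k} → κ G v w ≡ fin k → v ≢ w
κ≡fin⇒≢ {G = G} {v} e refl with trans (sym (κ-refl G v)) e
... | ()

module _ {n k} {G : Graph n} {B B′ : Fin k → Fin n} (B≗B′ : B ≗ B′) where

  rep-resp-≗ : ∀ v → rep G B v ≗ rep G B′ v
  rep-resp-≗ v i = cong (κ G v) (B≗B′ i)

  Resolving-resp-≗ : Resolving G B → Resolving G B′
  Resolving-resp-≗ R = rep-injective⇒Resolving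
    (λ e → proj₁ R (trans (B≗B′ _) (trans e (sym (B≗B′ _)))))
    (λ {v₁} {v₂} e → Resolving⇒rep-injective R λ i →
      trans (rep-resp-≗ v₁ i) (trans (e i) (sym (rep-resp-≗ v₂ i))))

  HasOneRep-resp-≗ : ∀ {v} → HasOneRep G B v → HasOneRep G B′ v
  HasOneRep-resp-≗ {v} one i = trans (sym (rep-resp-≗ v i)) (one i)

∷-OneRepFree : ∀ {n k} {G : Graph n} {B : Fin k → Fin n} {x} → Resolving G B → HasOneRep G B x →
  Resolving G (x Vec.∷ B) × OneRepFree G (x Vec.∷ B)
∷-OneRepFree {G = G} {B} {x} R one =
  rep-injective⇒Resolving injective (λ e → Resolving⇒rep-injective R (λ i → e (suc i))) , no-one
  where
  injective : Injective _≡_ _≡_ (x Vec.∷ B)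
  injective {zero} {zero} _ = refl
  injective {zero} {suc j} x≡Bj = ⊥-elim (κ≡fin⇒≢ (one j) x≡Bj)
  injective {suc i} {zero} Bi≡x = ⊥-elim (κ≡fin⇒≢ (one i) (sym Bi≡x))
  injective {suc i} {suc j} e = cong suc (proj₁ R e)
  no-one : OneRepFree G (x Vec.∷ B)
  no-one (v , one-v) =
    κ≡fin⇒≢ (one-v zero) (Resolving⇒rep-injective R (λ i → trans (one-v (suc i)) (sym (one i))))

forcesOne⊎oneRepFree : ∀ {n k} {G : Graph n} → IsCdim G k →
  ForcesOne G ⊎ ∃ λ (B : Fin k → Fin n) → Resolving G B × OneRepFree G B
forcesOne⊎oneRepFree {k = k} {G} (B₀ , R₀ , lb₀)
  with any-Vector? k resp (λ B → resolving? G B ×-dec ¬? (any? (hasOneRep? G B)))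
  where
  resp : ∀ {B B′} → B ≗ B′ → Resolving G B × OneRepFree G B → Resolving G B′ × OneRepFree G B′
  resp B≗B′ (R , free) =
    Resolving-resp-≗ B≗B′ R , λ (v , one) → free (v , HasOneRep-resp-≗ (λ i → sym (B≗B′ i)) one)
... | yes found = inj₂ found
... | no none = inj₁ forces
  where
  forces : ForcesOne G
  forces k′ B (R , lb) with ≤-antisym (lb₀ k′ B R) (lb k B₀ R₀)
  ... | refl with decidable-stable (any? (hasOneRep? G B)) (λ no-one → none (B , R , no-one))
  ...   | v , one = v , λ i → subst (HasConn G v (B i)) (one i) (κ-spec G v (B i))

Adj-sym : ∀ {n} (G : Graph n) {u v} → Adj G u v → Adj G v u
Adj-sym G {u} {v} = subst T (adj-sym G u v)

SimpleWalk : ∀ {n} → Graph n → List (Fin n) → Set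
SimpleWalk G s = Unique s × Linked (Adj G) s

-- Unlike a path, a route may have equal ends (then it is a single vertex).
record Route {n} (G : Graph n) (u v : Fin n) (s : List (Fin n)) : Set where
  constructor mkRoute
  field
    walk : SimpleWalk G s
    starts : ∃ λ t → s ≡ u ∷ t
    ends : ∃ λ t → s ≡ t ∷ʳ v

module _ {n} {G : Graph n} where

  route : Connected G → ∀ u v → ∃ (Route G u v)
  route connected u v with u ≟ v
  ... | yes refl = u ∷ [] , mkRoute ([] ∷ [] , [-]) ([] , refl) ([] , refl)
  ... | no u≢v with connected u v u≢v
  ...   | is , walk = u ∷ is ∷ʳ v , mkRoute walk (is ∷ʳ v , refl) (u ∷ is , refl)

  Route-++ : ∀ {x y y′ z s t} → Route G x y s → Route G y′ z t → Adj G y y′ → Disjoint s t →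
    Route G x z (s ++ t)
  Route-++ {y = y} {y′} {z} {s} {t}
    (mkRoute (u-s , l-s) (s′ , refl) (s″ , s≡)) (mkRoute (u-t , l-t) (t′ , refl) (t″ , t≡)) y~y′ s#t =
    mkRoute (Unique.++⁺ u-s u-t s#t , Linked.++⁺ l-s y→y′ l-t)
      (s′ ++ t , refl)
      (s ++ t″ , trans (cong (s ++_) t≡) (sym (++-assoc s t″ (z ∷ []))))
    where
    y→y′ : Maybe.Connected (Adj G) (last s) (just y′)
    y→y′ = subst (λ m → Maybe.Connected (Adj G) m (just y′))
                 (sym (trans (cong last s≡) (last-∷ʳ s″))) (Maybe.just y~y′)

  Route⇒IsPath : ∀ {x z s} → x ≢ z → Route G x z s → ∃ (IsPath G x z)
  Route⇒IsPath x≢z (mkRoute _ (_ , refl) ([] , e)) = ⊥-elim (x≢z (∷-injectiveˡ e))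
  Route⇒IsPath x≢z (mkRoute walk (_ , refl) (_ ∷ t , e)) with ∷-injective e
  ... | refl , refl = t , walk

module Embedding {m n} {K : Graph m} {H : Graph n} (ι : Fin m → Fin n) (ι-injective : Injective _≡_ _≡_ ι)
  (adj-ι : ∀ a b → adj H (ι a) (ι b) ≡ adj K a b) where

  SimpleWalk-map⁺ : ∀ {s} → SimpleWalk K s → SimpleWalk H (map ι s)
  SimpleWalk-map⁺ (u , l) = Unique.map⁺ ι-injective u , Linked.map⁺ (Linked.map (subst T (sym (adj-ι _ _))) l)

  SimpleWalk-map⁻ : ∀ {s} → SimpleWalk H (map ι s) → SimpleWalk K s
  SimpleWalk-map⁻ (u , l) = Unique.map⁻ u , Linked.map (subst T (adj-ι _ _)) (Linked.map⁻ l)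

  Route-map : ∀ {u v s} → Route K u v s → Route H (ι u) (ι v) (map ι s)
  Route-map {v = v} (mkRoute walk (t , refl) (t′ , s≡)) =
    mkRoute (SimpleWalk-map⁺ walk) (map ι t , refl)
      (map ι t′ , trans (cong (map ι) s≡) (map-∷ʳ ι t′ v))

  IsPath-map⁺ : ∀ {a b is} → IsPath K a b is → IsPath H (ι a) (ι b) (map ι is)
  IsPath-map⁺ {a} {b} {is} p = subst (SimpleWalk H) (map-∷ʳ ι (a ∷ is) b) (SimpleWalk-map⁺ p)

  IsPath-map⁻ : ∀ {a b is} → IsPath H (ι a) (ι b) (map ι is) → IsPath K a b is
  IsPath-map⁻ {a} {b} {is} p = SimpleWalk-map⁻ (subst (SimpleWalk H) (sym (map-∷ʳ ι (a ∷ is) b)) p)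

  Disjoint-map⁺ : ∀ {p q} → Disjoint p q → Disjoint (map ι p) (map ι q)
  Disjoint-map⁺ p#q (x∈p , x∈q) with ∈-map⁻ ι x∈p | ∈-map⁻ ι x∈q
  ... | c , c∈p , refl | d , d∈q , ιc≡ιd = p#q (c∈p , subst (_∈ _) (ι-injective (sym ιc≡ιd)) d∈q)

  Disjoint-map⁻ : ∀ {p q} → Disjoint (map ι p) (map ι q) → Disjoint p q
  Disjoint-map⁻ ιp#ιq (x∈p , x∈q) = ιp#ιq (∈-map⁺ ι x∈p , ∈-map⁺ ι x∈q)

  family-map⁺ : ∀ {a b ps} → IsDisjointPathFamily K a b ps →
    IsDisjointPathFamily H (ι a) (ι b) (map (map ι) ps)
  family-map⁺ (paths , distinct) =
    All.map⁺ (All.map IsPath-map⁺ paths) ,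
    AllPairs.map⁺ (AllPairs.map
      (λ (p≢q , p#q) → (λ e → p≢q (map-injective ι-injective e)) , λ {x} → Disjoint-map⁺ p#q {x}) distinct)

  family-map⁻ : ∀ {a b ps} → IsDisjointPathFamily H (ι a) (ι b) (map (map ι) ps) →
    IsDisjointPathFamily K a b ps
  family-map⁻ (paths , distinct) =
    All.map IsPath-map⁻ (All.map⁻ paths) ,
    AllPairs.map
      (λ (p≢q , p#q) → (λ e → p≢q (cong (map ι) e)) , λ {x} → Disjoint-map⁻ p#q {x}) (AllPairs.map⁻ distinct)

  module _ (path-closed : ∀ {a b is} → IsPath H (ι a) (ι b) is → ∃ λ is′ → map ι is′ ≡ is) where

    preimage : ∀ {a b qs} → All (IsPath H (ι a) (ι b)) qs → ∃ λ ps → map (map ι) ps ≡ qs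
    preimage [] = [] , refl
    preimage (q ∷ qs) with path-closed q | preimage qs
    ... | p , refl | ps , refl = p ∷ ps , refl

    HasConn-map : ∀ {a b} c → HasConn K a b c → HasConn H (ι a) (ι b) c
    HasConn-map ∞ a≡b = cong ι a≡b
    HasConn-map {a} {b} (fin k) (a≢b , (ps , fam , refl) , max) =
      (λ e → a≢b (ι-injective e)) , (map (map ι) ps , family-map⁺ fam , length-map _ ps) , max′
      where
      max′ : ∀ qs → IsDisjointPathFamily H (ι a) (ι b) qs → length qs ≤ length ps
      max′ qs fam′ with preimage (proj₁ fam′)
      ... | ps′ , refl = subst (_≤ length ps) (sym (length-map _ ps′)) (max ps′ (family-map⁻ fam′))

    κ-map : ∀ a b → κ H (ι a) (ι b) ≡ κ K a b
    κ-map a b = sym (HasConn⇒≡κ (HasConn-map _ (κ-spec K a b)))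

-- H is K₁ ⊔ K₂ (embedded by ι₁, ι₂) plus the single edge ι₁ end₁ ι₂ end₂;
-- stated abstractly so that swap can exchange the two sides.
record IsBridgeJoin {N n₁ n₂} (H : Graph N) (K₁ : Graph n₁) (K₂ : Graph n₂) : Set where
  field
    ι₁ : Fin n₁ → Fin N
    ι₂ : Fin n₂ → Fin N
    ι₁-injective : Injective _≡_ _≡_ ι₁
    ι₂-injective : Injective _≡_ _≡_ ι₂
    ι₁≢ι₂ : ∀ a b → ι₁ a ≢ ι₂ b
    ι-cover : ∀ x → (∃ λ a → ι₁ a ≡ x) ⊎ (∃ λ b → ι₂ b ≡ x)
    adj-ι₁ : ∀ a b → adj H (ι₁ a) (ι₁ b) ≡ adj K₁ a b
    adj-ι₂ : ∀ a b → adj H (ι₂ a) (ι₂ b) ≡ adj K₂ a b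
    end₁ : Fin n₁
    end₂ : Fin n₂
    bridge-edge : Adj H (ι₁ end₁) (ι₂ end₂)
    only-bridge : ∀ {a b} → Adj H (ι₁ a) (ι₂ b) → a ≡ end₁ × b ≡ end₂

swap : ∀ {N n₁ n₂} {H : Graph N} {K₁ : Graph n₁} {K₂ : Graph n₂} →
  IsBridgeJoin H K₁ K₂ → IsBridgeJoin H K₂ K₁
swap {H = H} S = record
  { ι₁ = ι₂ ; ι₂ = ι₁ ; ι₁-injective = ι₂-injective ; ι₂-injective = ι₁-injective
  ; ι₁≢ι₂ = λ b a e → ι₁≢ι₂ a b (sym e)
  ; ι-cover = λ x → Sum.swap (ι-cover x)
  ; adj-ι₁ = adj-ι₂ ; adj-ι₂ = adj-ι₁
  ; end₁ = end₂ ; end₂ = end₁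
  ; bridge-edge = Adj-sym H bridge-edge
  ; only-bridge = λ e → Product.swap (only-bridge (Adj-sym H e)) }
  where open IsBridgeJoin S

module Crossing {N n₁ n₂} {H : Graph N} {K₁ : Graph n₁} {K₂ : Graph n₂}
  (S : IsBridgeJoin H K₁ K₂) where
  open IsBridgeJoin S

  crosses-bridge : ∀ {a b} xs → Linked (Adj H) (ι₁ a ∷ xs ∷ʳ ι₂ b) →
    ι₁ end₁ ∈ ι₁ a ∷ xs × ι₂ end₂ ∈ xs ∷ʳ ι₂ b
  crosses-bridge [] (e ∷ _) with only-bridge e
  ... | refl , refl = here refl , here refl
  crosses-bridge (x ∷ xs) (e ∷ l) with ι-cover x
  ... | inj₁ (_ , refl) = Product.map there there (crosses-bridge xs l)
  ... | inj₂ (_ , refl) with only-bridge e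
  ...   | refl , refl = here refl , here refl

module BridgeJoinConnectivity {N n₁ n₂} {H : Graph N} {K₁ : Graph n₁} {K₂ : Graph n₂}
  (S : IsBridgeJoin H K₁ K₂) where
  open IsBridgeJoin S
  open Crossing S using (crosses-bridge)
  open Crossing (swap S) using () renaming (crosses-bridge to crosses-bridge-back)
  module E₁ = Embedding {K = K₁} {H = H} ι₁ ι₁-injective adj-ι₁
  module E₂ = Embedding {K = K₂} {H = H} ι₂ ι₂-injective adj-ι₂

  -- Leaving K₁ uses the bridge at end₁, and coming back would visit ι₁ end₁ again.
  stays-in-K₁ : ∀ {a b} is → IsPath H (ι₁ a) (ι₁ b) is → ∃ λ is₁ → map ι₁ is₁ ≡ is
  stays-in-K₁ [] _ = [] , refl
  stays-in-K₁ (x ∷ is) (ιa∉ ∷ u , e ∷ l) with ι-cover x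
  ... | inj₁ (c , refl) with stays-in-K₁ is (u , l)
  ...   | is₁ , refl = c ∷ is₁ , refl
  stays-in-K₁ (x ∷ is) (ιa∉ ∷ u , e ∷ l) | inj₂ (c , refl) with only-bridge e
  ...   | refl , _ = ⊥-elim (All.lookup ιa∉ (there (proj₂ (crosses-bridge-back is l))) refl)

  κ-ι₁ : ∀ a b → κ H (ι₁ a) (ι₁ b) ≡ κ K₁ a b
  κ-ι₁ = E₁.κ-map (stays-in-K₁ _)

  end-or-interior : ∀ {a b p} → IsPath H (ι₁ a) (ι₂ b) p →
    (a ≡ end₁ ⊎ ι₁ end₁ ∈ p) × (b ≡ end₂ ⊎ ι₂ end₂ ∈ p)
  end-or-interior {a} {b} {p} (_ , l) = Product.map start end (crosses-bridge p l)
    where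
    start : ι₁ end₁ ∈ ι₁ a ∷ p → a ≡ end₁ ⊎ ι₁ end₁ ∈ p
    start (here e) = inj₁ (ι₁-injective (sym e))
    start (there m) = inj₂ m
    end : ι₂ end₂ ∈ p ∷ʳ ι₂ b → b ≡ end₂ ⊎ ι₂ end₂ ∈ p
    end m with ∈-++⁻ p m
    ... | inj₁ m′ = inj₂ m′
    ... | inj₂ (here e) = inj₁ (ι₂-injective (sym e))

  bridge-path-trivial : ∀ {p} → IsPath H (ι₁ end₁) (ι₂ end₂) p → p ≡ []
  bridge-path-trivial {[]} _ = refl
  bridge-path-trivial {x ∷ p} (start∉ ∷ u , e ∷ l) with ι-cover x
  ... | inj₁ (_ , refl) =
    ⊥-elim (Unique[x∷xs]⇒x∉xs (start∉ ∷ u) (∈-++⁺ˡ (proj₁ (crosses-bridge p l))))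
  ... | inj₂ (_ , refl) with only-bridge e
  ...   | _ , refl = ⊥-elim (Unique[x∷xs]⇒x∉xs u (∈-++⁺ʳ p (here refl)))

  -- Every path across contains both ends of the bridge, as interior vertices unless
  -- they are its endpoints; and then the path is the bridge itself.
  no-two-paths-across : ∀ {a b p q} → IsPath H (ι₁ a) (ι₂ b) p → IsPath H (ι₁ a) (ι₂ b) q →
    p ≢ q → Disjoint p q → ⊥
  no-two-paths-across {p = p} {q} P Q p≢q p#q
    with shared (proj₁ (end-or-interior P)) (proj₁ (end-or-interior Q))
       | shared (proj₂ (end-or-interior P)) (proj₂ (end-or-interior Q))
    where
    shared : ∀ {X : Set} {y} → X ⊎ y ∈ p → X ⊎ y ∈ q → X
    shared (inj₁ x) _ = x
    shared _ (inj₁ x) = x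
    shared (inj₂ y∈p) (inj₂ y∈q) = ⊥-elim (p#q (y∈p , y∈q))
  ... | refl | refl = p≢q (trans (bridge-path-trivial P) (sym (bridge-path-trivial Q)))

  module _ (K₁-connected : Connected K₁) (K₂-connected : Connected K₂) where

    path-across : ∀ a b → ∃ (IsPath H (ι₁ a) (ι₂ b))
    path-across a b with route {G = K₁} K₁-connected a end₁ | route {G = K₂} K₂-connected end₂ b
    ... | s₁ , r₁ | s₂ , r₂ = Route⇒IsPath (ι₁≢ι₂ a b) (Route-++
      (E₁.Route-map r₁) (E₂.Route-map r₂)
      bridge-edge (λ {x} → separated {x}))
      where
      separated : Disjoint (map ι₁ s₁) (map ι₂ s₂)
      separated (x∈₁ , x∈₂) with ∈-map⁻ ι₁ x∈₁ | ∈-map⁻ ι₂ x∈₂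
      ... | c , _ , refl | d , _ , ιc≡ιd = ι₁≢ι₂ c d ιc≡ιd

    κ-across : ∀ a b → κ H (ι₁ a) (ι₂ b) ≡ fin 1
    κ-across a b with path-across a b
    ... | p , P = sym (HasConn⇒≡κ (ι₁≢ι₂ a b , (p ∷ [] , (P ∷ [] , [] ∷ []) , refl) , at-most-one))
      where
      at-most-one : ∀ ps → IsDisjointPathFamily H (ι₁ a) (ι₂ b) ps → length ps ≤ 1
      at-most-one [] _ = z≤n
      at-most-one (_ ∷ []) _ = s≤s z≤n
      at-most-one (_ ∷ _ ∷ _) (P ∷ Q ∷ _ , ((p≢q , p#q) ∷ _) ∷ _) =
        ⊥-elim (no-two-paths-across P Q p≢q (λ {x} → p#q {x}))

module _ {N n₁ n₂} {H : Graph N} {K₁ : Graph n₁} {K₂ : Graph n₂} (S : IsBridgeJoin H K₁ K₂) where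
  open IsBridgeJoin S

  Within : ∀ {m m₁ m₂} → (Fin m → Fin N) → (Fin m₁ → Fin n₁) → (Fin m₂ → Fin n₂) → Set
  Within W U₁ U₂ = ∀ j → (∃ λ i → W j ≡ ι₁ (U₁ i)) ⊎ (∃ λ i → W j ≡ ι₂ (U₂ i))

  Includes : ∀ {m m₁} → (Fin m → Fin N) → (Fin m₁ → Fin n₁) → Set
  Includes W U₁ = ∀ i → ∃ λ j → W j ≡ ι₁ (U₁ i)

  restrict₁ : List (Fin N) → List (Fin n₁)
  restrict₁ [] = []
  restrict₁ (x ∷ xs) with ι-cover x
  ... | inj₁ (a , _) = a ∷ restrict₁ xs
  ... | inj₂ _ = restrict₁ xs

  ∈-restrict₁⁺ : ∀ {a xs} → ι₁ a ∈ xs → a ∈ restrict₁ xs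
  ∈-restrict₁⁺ {xs = x ∷ xs} ιa∈ with ι-cover x | ιa∈
  ... | inj₁ (_ , refl) | here e = here (ι₁-injective e)
  ... | inj₁ (_ , refl) | there m = there (∈-restrict₁⁺ m)
  ... | inj₂ (b , refl) | here e = ⊥-elim (ι₁≢ι₂ _ b e)
  ... | inj₂ (_ , refl) | there m = ∈-restrict₁⁺ m

  ∈-restrict₁⁻ : ∀ {a xs} → a ∈ restrict₁ xs → ι₁ a ∈ xs
  ∈-restrict₁⁻ {xs = x ∷ xs} a∈ with ι-cover x | a∈
  ... | inj₁ (_ , refl) | here refl = here refl
  ... | inj₁ (_ , refl) | there m = there (∈-restrict₁⁻ m)
  ... | inj₂ (_ , refl) | m = there (∈-restrict₁⁻ m)

  restrict₁-unique : ∀ {xs} → Unique xs → Unique (restrict₁ xs)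
  restrict₁-unique {[]} [] = []
  restrict₁-unique {x ∷ xs} (x∉xs ∷ u) with ι-cover x
  ... | inj₁ (_ , refl) =
    All.tabulate (λ c∈ e → All.lookup x∉xs (∈-restrict₁⁻ c∈) (cong ι₁ e)) ∷ restrict₁-unique u
  ... | inj₂ _ = restrict₁-unique u

module BridgeJoinRep {N n₁ n₂} {H : Graph N} {K₁ : Graph n₁} {K₂ : Graph n₂}
  (S : IsBridgeJoin H K₁ K₂) (K₁-connected : Connected K₁) (K₂-connected : Connected K₂) where
  open IsBridgeJoin S
  open BridgeJoinConnectivity S using (κ-ι₁; κ-across)
  open BridgeJoinConnectivity (swap S) using () renaming (κ-across to κ-across-back)

  κ-at-ι₁ : ∀ {a x c} → x ≡ ι₁ c → κ H (ι₁ a) x ≡ κ K₁ a c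
  κ-at-ι₁ {a} {c = c} refl = κ-ι₁ a c

  κ-at-ι₂ : ∀ {a x c} → x ≡ ι₂ c → κ H (ι₁ a) x ≡ fin 1
  κ-at-ι₂ {a} {c = c} refl = κ-across K₁-connected K₂-connected a c

  κ-back-at-ι₁ : ∀ {b x c} → x ≡ ι₁ c → κ H (ι₂ b) x ≡ fin 1
  κ-back-at-ι₁ {b} {c = c} refl = κ-across-back K₂-connected K₁-connected b c

  module _ {m m₁ m₂} {W : Fin m → Fin N} {U₁ : Fin m₁ → Fin n₁} {U₂ : Fin m₂ → Fin n₂}
    (within : Within S W U₁ U₂) where

    rep-ι₁-≗ : ∀ {a a′} → rep K₁ U₁ a ≗ rep K₁ U₁ a′ → rep H W (ι₁ a) ≗ rep H W (ι₁ a′)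
    rep-ι₁-≗ e j with within j
    ... | inj₁ (i , Wj≡) = trans (κ-at-ι₁ Wj≡) (trans (e i) (sym (κ-at-ι₁ Wj≡)))
    ... | inj₂ (_ , Wj≡) = trans (κ-at-ι₂ Wj≡) (sym (κ-at-ι₂ Wj≡))

    HasOneRep-ι₁ : ∀ {a} → HasOneRep K₁ U₁ a → HasOneRep H W (ι₁ a)
    HasOneRep-ι₁ one j with within j
    ... | inj₁ (i , Wj≡) = trans (κ-at-ι₁ Wj≡) (one i)
    ... | inj₂ (_ , Wj≡) = κ-at-ι₂ Wj≡

  module _ {m m₁} {W : Fin m → Fin N} {U₁ : Fin m₁ → Fin n₁} (includes : Includes S W U₁) where

    rep-ι₁-≗⁻ : ∀ {a a′} → rep H W (ι₁ a) ≗ rep H W (ι₁ a′) → rep K₁ U₁ a ≗ rep K₁ U₁ a′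
    rep-ι₁-≗⁻ e i = let (j , Wj≡) = includes i in
      trans (sym (κ-at-ι₁ Wj≡)) (trans (e j) (κ-at-ι₁ Wj≡))

    HasOneRep-ι₁⁻ : ∀ {a b} → rep H W (ι₁ a) ≗ rep H W (ι₂ b) → HasOneRep K₁ U₁ a
    HasOneRep-ι₁⁻ e i = let (j , Wj≡) = includes i in
      trans (sym (κ-at-ι₁ Wj≡)) (trans (e j) (κ-back-at-ι₁ Wj≡))

module BridgeJoinResolving {N n₁ n₂} {H : Graph N} {K₁ : Graph n₁} {K₂ : Graph n₂}
  (S : IsBridgeJoin H K₁ K₂) (K₁-connected : Connected K₁) (K₂-connected : Connected K₂) where
  open IsBridgeJoin S
  open BridgeJoinRep S K₁-connected K₂-connected
  open BridgeJoinRep (swap S) K₂-connected K₁-connected using () renaming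
    ( rep-ι₁-≗ to rep-ι₂-≗; rep-ι₁-≗⁻ to rep-ι₂-≗⁻
    ; HasOneRep-ι₁ to HasOneRep-ι₂; HasOneRep-ι₁⁻ to HasOneRep-ι₂⁻)

  resolving-++ : ∀ {k₁ k₂} {B₁ : Fin k₁ → Fin n₁} {B₂ : Fin k₂ → Fin n₂} →
    Resolving K₁ B₁ → Resolving K₂ B₂ → OneRepFree K₁ B₁ ⊎ OneRepFree K₂ B₂ →
    Resolving H ((λ i → ι₁ (B₁ i)) Vec.++ (λ i → ι₂ (B₂ i)))
  resolving-++ {k₁} {k₂} {B₁} {B₂} R₁ R₂ free = rep-injective⇒Resolving
    (++-injective (λ e → proj₁ R₁ (ι₁-injective e)) (λ e → proj₁ R₂ (ι₂-injective e)) (λ i j → ι₁≢ι₂ (B₁ i) (B₂ j)))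
    separates
    where
    W : Fin (k₁ + k₂) → Fin N
    W = (λ i → ι₁ (B₁ i)) Vec.++ (λ i → ι₂ (B₂ i))
    includes₁ : Includes S W B₁
    includes₁ i = i ↑ˡ k₂ , lookup-++ˡ _ (λ i → ι₂ (B₂ i)) i
    includes₂ : Includes (swap S) W B₂
    includes₂ i = k₁ ↑ʳ i , lookup-++ʳ (λ i → ι₁ (B₁ i)) _ i
    no-cross : ∀ {a b} → ¬ (rep H W (ι₁ a) ≗ rep H W (ι₂ b))
    no-cross {a} {b} e = Sum.[ (λ free₁ → free₁ (a , HasOneRep-ι₁⁻ includes₁ e))
                             , (λ free₂ → free₂ (b , HasOneRep-ι₂⁻ includes₂ (λ j → sym (e j)))) ] free
    separates : ∀ {x y} → rep H W x ≗ rep H W y → x ≡ y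
    separates {x} {y} e with ι-cover x | ι-cover y
    ... | inj₁ (_ , refl) | inj₁ (_ , refl) =
      cong ι₁ (Resolving⇒rep-injective R₁ (rep-ι₁-≗⁻ includes₁ e))
    ... | inj₂ (_ , refl) | inj₂ (_ , refl) =
      cong ι₂ (Resolving⇒rep-injective R₂ (rep-ι₂-≗⁻ includes₂ e))
    ... | inj₁ (_ , refl) | inj₂ (_ , refl) = ⊥-elim (no-cross e)
    ... | inj₂ (_ , refl) | inj₁ (_ , refl) = ⊥-elim (no-cross (λ j → sym (e j)))

  record Split {m} (W : Fin m → Fin N) : Set where
    field
      m₁ m₂ : ℕ
      U₁ : Fin m₁ → Fin n₁
      U₂ : Fin m₂ → Fin n₂
      U₁-injective : Injective _≡_ _≡_ U₁
      U₂-injective : Injective _≡_ _≡_ U₂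
      within : Within S W U₁ U₂
      m₁+m₂≡m : m₁ + m₂ ≡ m

    resolving₁ : Resolving H W → Resolving K₁ U₁
    resolving₁ R = rep-injective⇒Resolving U₁-injective
      (λ e → ι₁-injective (Resolving⇒rep-injective R (rep-ι₁-≗ within e)))

    resolving₂ : Resolving H W → Resolving K₂ U₂
    resolving₂ R = rep-injective⇒Resolving U₂-injective
      (λ e → ι₂-injective (Resolving⇒rep-injective R (rep-ι₂-≗ (λ j → Sum.swap (within j)) e)))

  length-restrict₁+restrict₂ : ∀ xs →
    length (restrict₁ S xs) + length (restrict₁ (swap S) xs) ≡ length xs
  length-restrict₁+restrict₂ [] = refl
  length-restrict₁+restrict₂ (x ∷ xs) with ι-cover x
  ... | inj₁ _ = cong suc (length-restrict₁+restrict₂ xs)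
  ... | inj₂ _ = trans (+-suc _ _) (cong suc (length-restrict₁+restrict₂ xs))

  split : ∀ {m} {W : Fin m → Fin N} → Injective _≡_ _≡_ W → Split W
  split {W = W} W-injective = record
    { U₁ = lookup L₁ ; U₂ = lookup L₂
    ; U₁-injective = Unique⇒lookup-injective (restrict₁-unique S W-unique)
    ; U₂-injective = Unique⇒lookup-injective (restrict₁-unique (swap S) W-unique)
    ; within = within
    ; m₁+m₂≡m = trans (length-restrict₁+restrict₂ (tabulate W)) (length-tabulate W) }
    where
    W-unique : Unique (tabulate W)
    W-unique = Unique.tabulate⁺ W-injective
    L₁ : List (Fin n₁)
    L₁ = restrict₁ S (tabulate W)
    L₂ : List (Fin n₂)
    L₂ = restrict₁ (swap S) (tabulate W)
    within : Within S W (lookup L₁) (lookup L₂)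
    within j with ι-cover (W j)
    ... | inj₁ (a , ιa≡Wj) =
      let a∈ = ∈-restrict₁⁺ S (subst (_∈ tabulate W) (sym ιa≡Wj) (∈-tabulate⁺ j)) in
      inj₁ (Any.index a∈ , trans (sym ιa≡Wj) (cong ι₁ (lookup-index a∈)))
    ... | inj₂ (b , ιb≡Wj) =
      let b∈ = ∈-restrict₁⁺ (swap S) (subst (_∈ tabulate W) (sym ιb≡Wj) (∈-tabulate⁺ j)) in
      inj₂ (Any.index b∈ , trans (sym ιb≡Wj) (cong ι₂ (lookup-index b∈)))

  oneReps-collide : ∀ {m m₁ m₂} {W : Fin m → Fin N} {U₁ : Fin m₁ → Fin n₁} {U₂ : Fin m₂ → Fin n₂} {a b} →
    Within S W U₁ U₂ → HasOneRep K₁ U₁ a → HasOneRep K₂ U₂ b → ¬ Resolving H W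
  oneReps-collide {a = a} {b} within one₁ one₂ R = ι₁≢ι₂ a b (Resolving⇒rep-injective R λ j →
    trans (HasOneRep-ι₁ within one₁ j) (sym (HasOneRep-ι₂ (λ j → Sum.swap (within j)) one₂ j)))

  lower-bound : ∀ {k₁ k₂} → LowerBound K₁ k₁ → LowerBound K₂ k₂ → LowerBound H (k₁ + k₂)
  lower-bound lb₁ lb₂ m W R =
    subst (_ ≤_) m₁+m₂≡m (+-mono-≤ (lb₁ _ U₁ (resolving₁ R)) (lb₂ _ U₂ (resolving₂ R)))
    where open Split (split (proj₁ R))

  lower-bound-forced : ∀ {k₁ k₂} → ForcesOne K₁ → ForcesOne K₂ → LowerBound K₁ k₁ → LowerBound K₂ k₂ →
    LowerBound H (suc (k₁ + k₂))
  lower-bound-forced {k₁} {k₂} F₁ F₂ lb₁ lb₂ m W R =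
    bound (m≤n⇒m<n∨m≡n (lb₁ _ U₁ R₁)) (m≤n⇒m<n∨m≡n (lb₂ _ U₂ R₂))
    where
    open Split (split (proj₁ R))
    R₁ : Resolving K₁ U₁
    R₁ = resolving₁ R
    R₂ : Resolving K₂ U₂
    R₂ = resolving₂ R
    bound : k₁ < m₁ ⊎ k₁ ≡ m₁ → k₂ < m₂ ⊎ k₂ ≡ m₂ → suc (k₁ + k₂) ≤ m
    bound (inj₁ k₁<m₁) _ = subst (_ ≤_) m₁+m₂≡m (+-mono-<-≤ k₁<m₁ (lb₂ _ U₂ R₂))
    bound (inj₂ _) (inj₁ k₂<m₂) = subst (_ ≤_) m₁+m₂≡m (+-mono-≤-< (lb₁ _ U₁ R₁) k₂<m₂)
    bound (inj₂ k₁≡m₁) (inj₂ k₂≡m₂) = ⊥-elim (oneReps-collide within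
      (proj₂ (ForcesOne⇒HasOneRep F₁ (R₁ , subst (LowerBound K₁) k₁≡m₁ lb₁)))
      (proj₂ (ForcesOne⇒HasOneRep F₂ (R₂ , subst (LowerBound K₂) k₂≡m₂ lb₂))) R)

module _ {n₁ n₂} (G₁ : Graph n₁) (G₂ : Graph n₂) (v₁ : Fin n₁) (v₂ : Fin n₂) where
  private
    G : Graph (n₁ + n₂)
    G = bridge G₁ G₂ v₁ v₂

    adj-↑ˡ : ∀ a b → adj G (a ↑ˡ n₂) (b ↑ˡ n₂) ≡ adj G₁ a b
    adj-↑ˡ a b rewrite splitAt-↑ˡ n₁ a n₂ | splitAt-↑ˡ n₁ b n₂ = refl

    adj-↑ʳ : ∀ a b → adj G (n₁ ↑ʳ a) (n₁ ↑ʳ b) ≡ adj G₂ a b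
    adj-↑ʳ a b rewrite splitAt-↑ʳ n₁ n₂ a | splitAt-↑ʳ n₁ n₂ b = refl

    adj-↑ˡ-↑ʳ : ∀ a b → adj G (a ↑ˡ n₂) (n₁ ↑ʳ b) ≡ ⌊ a ≟ v₁ ⌋ ∧ ⌊ b ≟ v₂ ⌋
    adj-↑ˡ-↑ʳ a b rewrite splitAt-↑ˡ n₁ a n₂ | splitAt-↑ʳ n₁ n₂ b = refl

    cover : ∀ x → (∃ λ a → a ↑ˡ n₂ ≡ x) ⊎ (∃ λ b → n₁ ↑ʳ b ≡ x)
    cover x with splitAt n₁ x in eq
    ... | inj₁ a = inj₁ (a , splitAt⁻¹-↑ˡ eq)
    ... | inj₂ b = inj₂ (b , splitAt⁻¹-↑ʳ eq)

    ↑ˡ≢↑ʳ : ∀ a b → a ↑ˡ n₂ ≢ n₁ ↑ʳ b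
    ↑ˡ≢↑ʳ a b e with trans (sym (splitAt-↑ˡ n₁ a n₂)) (trans (cong (splitAt n₁) e) (splitAt-↑ʳ n₁ n₂ b))
    ... | ()

    only-bridge : ∀ {a b} → Adj G (a ↑ˡ n₂) (n₁ ↑ʳ b) → a ≡ v₁ × b ≡ v₂
    only-bridge {a} {b} e with a ≟ v₁ | b ≟ v₂ | subst T (adj-↑ˡ-↑ʳ a b) e
    ... | yes a≡v₁ | yes b≡v₂ | _ = a≡v₁ , b≡v₂

  bridge-isBridgeJoin : IsBridgeJoin G G₁ G₂
  bridge-isBridgeJoin = record
    { ι₁ = _↑ˡ n₂ ; ι₂ = n₁ ↑ʳ_
    ; ι₁-injective = ↑ˡ-injective n₂ _ _ ; ι₂-injective = ↑ʳ-injective n₁ _ _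
    ; ι₁≢ι₂ = ↑ˡ≢↑ʳ ; ι-cover = cover
    ; adj-ι₁ = adj-↑ˡ ; adj-ι₂ = adj-↑ʳ
    ; end₁ = v₁ ; end₂ = v₂
    ; bridge-edge = subst T (sym (adj-↑ˡ-↑ʳ v₁ v₂))
        (Equivalence.from T-∧ (fromWitness {a? = v₁ ≟ v₁} refl , fromWitness {a? = v₂ ≟ v₂} refl))
    ; only-bridge = only-bridge }

corollary3p4 : ∀ {n₁ n₂} (G₁ : Graph n₁) (G₂ : Graph n₂) (v₁ : Fin n₁) (v₂ : Fin n₂)
    → Connected G₁ → Connected G₂
    → ∀ k₁ k₂ → IsCdim G₁ k₁ → IsCdim G₂ k₂
    → (ForcesOne G₁ × ForcesOne G₂ → IsCdim (bridge G₁ G₂ v₁ v₂) (k₁ + k₂ + 1))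
      × (¬ (ForcesOne G₁ × ForcesOne G₂) → IsCdim (bridge G₁ G₂ v₁ v₂) (k₁ + k₂))
corollary3p4 G₁ G₂ v₁ v₂ c₁ c₂ k₁ k₂ cdim₁@(_ , R₁ , lb₁) cdim₂@(_ , R₂ , lb₂) = forced , unforced
  where
  open BridgeJoinResolving (bridge-isBridgeJoin G₁ G₂ v₁ v₂) c₁ c₂

  forced : ForcesOne G₁ × ForcesOne G₂ → IsCdim (bridge G₁ G₂ v₁ v₂) (k₁ + k₂ + 1)
  forced (F₁ , F₂) with ForcesOne⇒HasOneRep F₁ (R₁ , lb₁)
  ... | _ , one with ∷-OneRepFree R₁ one
  ...   | R₁′ , free₁′ = subst (IsCdim _) (+-comm 1 (k₁ + k₂))
          (_ , resolving-++ R₁′ R₂ (inj₁ free₁′) , lower-bound-forced F₁ F₂ lb₁ lb₂)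

  unforced : ¬ (ForcesOne G₁ × ForcesOne G₂) → IsCdim (bridge G₁ G₂ v₁ v₂) (k₁ + k₂)
  unforced ¬F with forcesOne⊎oneRepFree cdim₁ | forcesOne⊎oneRepFree cdim₂
  ... | inj₂ (_ , R , free) | _ = _ , resolving-++ R R₂ (inj₁ free) , lower-bound lb₁ lb₂
  ... | inj₁ _ | inj₂ (_ , R , free) = _ , resolving-++ R₁ R (inj₂ free) , lower-bound lb₁ lb₂
  ... | inj₁ F₁ | inj₁ F₂ = ⊥-elim (¬F (F₁ , F₂))
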